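{- Let $\alpha_1,\ldots,\alpha_k\in\mathbb{Q}$ and let $p_1,\ldots,p_k$ be distinct primes. Then the following are equivalent: (a) $\alpha_1,\ldots,\alpha_k\in\mathbb{Z}$; (b) $\prod_{i=1}^k p_i^{\alpha_i}\in\mathbb{Q}$; (c) $\prod_{i=1}^k p_i^{\alpha_i^2}\in\mathbb{Q}$.
   Context: Here $p_i^{\beta}$ for rational $\beta$ denotes the positive real number $p_i$ raised to the real power $\beta$. -}

module Defs where

open import Data.Nat as ℕ using (ℕ; zero; suc; NonZero)
open import Data.Nat.Properties using (m^n≢0)
open import Data.Nat.Primality using (Prime; prime⇒nonZero)
open import Data.Integer as ℤ using (ℤ; +_; -[1+_])
open import Data.Rational as ℚ using (ℚ; _/_; 1ℚ; _*_; Positive)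
open import Data.Fin using (Fin; zero; suc)
open import Data.Product using (Σ; ∃; ∃-syntax; _×_)
open import Relation.Binary.PropositionalEquality using (_≡_)

ℤ→ℚ : ℤ → ℚ
ℤ→ℚ z = z / 1

IsInteger : ℚ → Set
IsInteger q = ∃[ z ] q ≡ ℤ→ℚ z

_^ℚ_ : ℚ → ℕ → ℚ
q ^ℚ zero = 1ℚ
q ^ℚ suc n = q * (q ^ℚ n)

ppow : (p : ℕ) → .{{NonZero p}} → ℤ → ℚ
ppow p (+ n) = (+ (p ℕ.^ n)) / 1
ppow p -[1+ n ] = (+ 1) / (p ℕ.^ suc n)
  where instance _ = m^n≢0 p (suc n)

∏ : (k : ℕ) → (Fin k → ℚ) → ℚ
∏ zero f = 1ℚ
∏ (suc k) f = f zero * ∏ k (λ i → f (suc i))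

-- "The positive real number ∏ᵢ pᵢ^βᵢ is rational" (βᵢ ∈ ℚ, real powers).
-- Since ℝ is unavailable, we use the defining property of rational real
-- powers: for positive p and β with Nβ ∈ ℤ (N ≥ 1), p^β is the unique
-- positive real r with r^N = p^(Nβ).  Hence the real ∏ pᵢ^βᵢ equals a
-- rational q iff q > 0 and q^N = ∏ pᵢ^(Nβᵢ) for every N ≥ 1 making all
-- Nβᵢ integers (such N always exist).
ProdPowIsRational : (k : ℕ) (p : Fin k → ℕ) → (∀ i → Prime (p i)) →
                    (Fin k → ℚ) → Set
ProdPowIsRational k p pr β =
  ∃[ q ] Positive q ×
    ((N : ℕ) → NonZero N → (e : Fin k → ℤ) →
      (∀ i → ℤ→ℚ (e i) ≡ ℤ→ℚ (+ N) * β i) →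
      q ^ℚ N ≡ ∏ k (λ i → ppow (p i) {{prime⇒nonZero (pr i)}} (e i)))

{-# OPTIONS --safe #-}
module Submission where

-- Write a positive rational q as n / m.  If q ^ N = ∏ pᵢ ^ eᵢ with eᵢ = N αᵢ, the pᵢ-adic
-- valuations of the two sides of  n ^ N · ∏ pᵢ ^ eᵢ⁻ = ∏ pᵢ ^ eᵢ⁺ · m ^ N  (eᵢ = eᵢ⁺ − eᵢ⁻)
-- give eᵢ = N (v(n) − v(m)), so αᵢ ∈ ℤ.  Conversely, for integral αᵢ the rational ∏ pᵢ ^ αᵢ is
-- the required q.  For the squares: if α² ∈ ℤ then the reduced denominator of α divides
-- the square of its coprime numerator, hence is 1.

open import Defs
open import Data.Nat as ℕ using (ℕ; zero; suc; NonZero; _^_)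
import Data.Nat.Properties as ℕ
open import Data.Nat.Divisibility using (_∣_; _∤_; divides; _∣?_; ∣-refl; ∣-trans; ∣1⇒≡1; m∣m*n)
open import Data.Nat.Primality using (Prime; prime⇒nonZero; prime⇒nonTrivial; prime⇒irreducible; euclidsLemma)
open import Data.Nat.Coprimality as Coprimality using (Coprime; coprime-divisor)
open import Data.Nat.Induction using (<-rec)
open import Data.Integer as ℤ using (ℤ; +_; -[1+_]; +[1+_])
import Data.Integer.Properties as ℤ
open import Data.Integer.Solver using (module +-*-Solver)
open import Data.Rational as ℚ using (ℚ; mkℚ; _*_; _/_; ↥_; ↧ₙ_; 0ℚ; 1ℚ; 1/_; Positive; toℚᵘ)
open import Data.Rational.Literals using (fromℤ)
open import Data.Rational.Properties as ℚ
  using (↥p/↧p≡p; toℚᵘ-injective; toℚᵘ-homo-*; toℚᵘ-fromℚᵘ; normalize-pos; pos*pos⇒pos)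
import Data.Rational.Unnormalised as ℚᵘ
import Data.Rational.Unnormalised.Properties as ℚᵘ
open import Data.Fin using (Fin; zero; suc)
import Data.Fin.Properties as Fin
open import Data.Product using (_×_; ∃-syntax; _,_; proj₁; proj₂)
open import Data.Sum using ([_,_]′)
open import Function using (_⇔_; _∘_; mk⇔)
open import Function.Definitions using (Injective)
open import Algebra.Bundles using (CommutativeMonoid)
import Algebra.Properties.CommutativeSemigroup as CommSemigroupProperties
open import Relation.Nullary using (yes; no; contradiction)
open import Relation.Binary.PropositionalEquality
  using (_≡_; _≢_; refl; sym; trans; cong; cong₂; subst; subst₂; module ≡-Reasoning)

module ℕ* = CommSemigroupProperties ℕ.*-commutativeSemigroup
module ℚ* = CommSemigroupProperties (CommutativeMonoid.commutativeSemigroup ℚ.*-1-commutativeMonoid)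

-- ℤ→ℚ z = z / 1 goes through normalisation; fromℤ z is its normal form, on which ↥_ and _*_ compute.
ℤ→ℚ≡fromℤ : ∀ z → ℤ→ℚ z ≡ fromℤ z
ℤ→ℚ≡fromℤ z = ↥p/↧p≡p (fromℤ z)

ℤ→ℚ-injective : Injective _≡_ _≡_ ℤ→ℚ
ℤ→ℚ-injective {a} {b} eq = cong ↥_ (trans (sym (ℤ→ℚ≡fromℤ a)) (trans eq (ℤ→ℚ≡fromℤ b)))

ℤ→ℚ-homo-* : ∀ a b → ℤ→ℚ (a ℤ.* b) ≡ ℤ→ℚ a * ℤ→ℚ b
ℤ→ℚ-homo-* a b = sym (cong₂ _*_ (ℤ→ℚ≡fromℤ a) (ℤ→ℚ≡fromℤ b))

ℕ→ℚ-homo-* : ∀ m n → ℤ→ℚ (+ (m ℕ.* n)) ≡ ℤ→ℚ (+ m) * ℤ→ℚ (+ n)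
ℕ→ℚ-homo-* m n = trans (cong ℤ→ℚ (ℤ.pos-* m n)) (ℤ→ℚ-homo-* (+ m) (+ n))

ℕ→ℚ-≢0 : ∀ n .{{_ : NonZero n}} → ℤ→ℚ (+ n) ≢ 0ℚ
ℕ→ℚ-≢0 n eq = ℕ.≢-nonZero⁻¹ n (ℤ.+-injective (ℤ→ℚ-injective eq))

i/n*n≡i : ∀ i n .{{_ : NonZero n}} → i / n * ℤ→ℚ (+ n) ≡ ℤ→ℚ i
i/n*n≡i i n@(suc _) = toℚᵘ-injective (begin
  toℚᵘ (i / n * ℤ→ℚ (+ n))             ≈⟨ toℚᵘ-homo-* (i / n) (ℤ→ℚ (+ n)) ⟩
  toℚᵘ (i / n) ℚᵘ.* toℚᵘ (ℤ→ℚ (+ n))  ≈⟨ ℚᵘ.*-cong (toℚᵘ-fromℚᵘ (i ℚᵘ./ n)) (toℚᵘ-fromℚᵘ (+ n ℚᵘ./ 1)) ⟩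
  (i ℤ.* + n) ℚᵘ./ (n ℕ.* 1)           ≡⟨ ℚᵘ./-cong refl (ℕ.*-comm n 1) ⟩
  (i ℤ.* + n) ℚᵘ./ (1 ℕ.* n)           ≈⟨ ℚᵘ.*-cancelʳ-/ n {i} {1} ⟩
  i ℚᵘ./ 1                             ≈⟨ toℚᵘ-fromℚᵘ (i ℚᵘ./ 1) ⟨
  toℚᵘ (ℤ→ℚ i)                         ∎)
  where open ℚᵘ.≃-Reasoning

p*↧p≡↥p : ∀ p → p * ℤ→ℚ (+ ↧ₙ p) ≡ ℤ→ℚ (↥ p)
p*↧p≡↥p p = subst (λ x → x * ℤ→ℚ (+ ↧ₙ p) ≡ ℤ→ℚ (↥ p)) (↥p/↧p≡p p) (i/n*n≡i (↥ p) (↧ₙ p))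

*-cancelʳ-≢0 : ∀ {p q} r → r ≢ 0ℚ → p * r ≡ q * r → p ≡ q
*-cancelʳ-≢0 {p} {q} r r≢0 eq = begin
  p              ≡⟨ ℚ.*-identityʳ p ⟨
  p * 1ℚ         ≡⟨ cong (p *_) (ℚ.*-inverseʳ r) ⟨
  p * (r * 1/ r) ≡⟨ ℚ.*-assoc p r (1/ r) ⟨
  p * r * 1/ r   ≡⟨ cong (_* 1/ r) eq ⟩
  q * r * 1/ r   ≡⟨ ℚ.*-assoc q r (1/ r) ⟩
  q * (r * 1/ r) ≡⟨ cong (q *_) (ℚ.*-inverseʳ r) ⟩
  q * 1ℚ         ≡⟨ ℚ.*-identityʳ q ⟩
  q              ∎
  where
  open ≡-Reasoning
  instance
    r-nonZero : ℚ.NonZero r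
    r-nonZero = ℚ.≢-nonZero r≢0

∏ℕ : (k : ℕ) → (Fin k → ℕ) → ℕ
∏ℕ zero    f = 1
∏ℕ (suc k) f = f zero ℕ.* ∏ℕ k (f ∘ suc)

∏ℕ-cong : ∀ k {f g : Fin k → ℕ} → (∀ i → f i ≡ g i) → ∏ℕ k f ≡ ∏ℕ k g
∏ℕ-cong zero    _   = refl
∏ℕ-cong (suc k) f≗g = cong₂ ℕ._*_ (f≗g zero) (∏ℕ-cong k (f≗g ∘ suc))

^-distribʳ-* : ∀ m n N → (m ℕ.* n) ^ N ≡ m ^ N ℕ.* n ^ N
^-distribʳ-* m n zero    = refl
^-distribʳ-* m n (suc N) = trans (cong (m ℕ.* n ℕ.*_) (^-distribʳ-* m n N)) (ℕ*.interchange m n (m ^ N) (n ^ N))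

∏ℕ-^ : ∀ k (f : Fin k → ℕ) N → ∏ℕ k (λ i → f i ^ N) ≡ ∏ℕ k f ^ N
∏ℕ-^ zero    f N = sym (ℕ.^-zeroˡ N)
∏ℕ-^ (suc k) f N = trans (cong (f zero ^ N ℕ.*_) (∏ℕ-^ k (f ∘ suc) N)) (sym (^-distribʳ-* (f zero) (∏ℕ k (f ∘ suc)) N))

∏ℕ-nonZero : ∀ k {f : Fin k → ℕ} → (∀ i → NonZero (f i)) → NonZero (∏ℕ k f)
∏ℕ-nonZero zero    _          = _
∏ℕ-nonZero (suc k) {f} f≢0 = ℕ.m*n≢0 (f zero) (∏ℕ k (f ∘ suc)) {{f≢0 zero}} {{∏ℕ-nonZero k (f≢0 ∘ suc)}}

-- q = A / B, stated without division so that no NonZero B and no normalisation are involved.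
record IsRatio (q : ℚ) (A B : ℕ) : Set where
  constructor mkRatio
  field q*B≡A : q * ℤ→ℚ (+ B) ≡ ℤ→ℚ (+ A)

isRatio-* : ∀ {q r A B C D} → IsRatio q A B → IsRatio r C D → IsRatio (q * r) (A ℕ.* C) (B ℕ.* D)
isRatio-* {q} {r} {A} {B} {C} {D} (mkRatio q≡A/B) (mkRatio r≡C/D) = mkRatio (begin
  q * r * ℤ→ℚ (+ (B ℕ.* D))        ≡⟨ cong (q * r *_) (ℕ→ℚ-homo-* B D) ⟩
  q * r * (ℤ→ℚ (+ B) * ℤ→ℚ (+ D))  ≡⟨ ℚ*.interchange q r (ℤ→ℚ (+ B)) (ℤ→ℚ (+ D)) ⟩
  q * ℤ→ℚ (+ B) * (r * ℤ→ℚ (+ D))  ≡⟨ cong₂ _*_ q≡A/B r≡C/D ⟩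
  ℤ→ℚ (+ A) * ℤ→ℚ (+ C)            ≡⟨ ℕ→ℚ-homo-* A C ⟨
  ℤ→ℚ (+ (A ℕ.* C))                ∎)
  where open ≡-Reasoning

isRatio-^ : ∀ {q A B} N → IsRatio q A B → IsRatio (q ^ℚ N) (A ^ N) (B ^ N)
isRatio-^ zero    _     = mkRatio (ℚ.*-identityˡ 1ℚ)
isRatio-^ (suc N) q≡A/B = isRatio-* q≡A/B (isRatio-^ N q≡A/B)

isRatio-∏ : ∀ k {f : Fin k → ℚ} {A B : Fin k → ℕ} → (∀ i → IsRatio (f i) (A i) (B i)) → IsRatio (∏ k f) (∏ℕ k A) (∏ℕ k B)
isRatio-∏ zero    _     = mkRatio (ℚ.*-identityˡ 1ℚ)
isRatio-∏ (suc k) ratio = isRatio-* (ratio zero) (isRatio-∏ k (ratio ∘ suc))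

isRatio-cross : ∀ {q A B C D} → IsRatio q A B → IsRatio q C D → A ℕ.* D ≡ C ℕ.* B
isRatio-cross {q} {A} {B} {C} {D} (mkRatio q≡A/B) (mkRatio q≡C/D) = ℤ.+-injective (ℤ→ℚ-injective (begin
  ℤ→ℚ (+ (A ℕ.* D))           ≡⟨ ℕ→ℚ-homo-* A D ⟩
  ℤ→ℚ (+ A) * ℤ→ℚ (+ D)       ≡⟨ cong (_* ℤ→ℚ (+ D)) q≡A/B ⟨
  q * ℤ→ℚ (+ B) * ℤ→ℚ (+ D)   ≡⟨ ℚ*.xy∙z≈xz∙y q (ℤ→ℚ (+ B)) (ℤ→ℚ (+ D)) ⟩
  q * ℤ→ℚ (+ D) * ℤ→ℚ (+ B)   ≡⟨ cong (_* ℤ→ℚ (+ B)) q≡C/D ⟩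
  ℤ→ℚ (+ C) * ℤ→ℚ (+ B)       ≡⟨ ℕ→ℚ-homo-* C B ⟨
  ℤ→ℚ (+ (C ℕ.* B))           ∎))
  where open ≡-Reasoning

isRatio-injective : ∀ {q r A B} .{{_ : NonZero B}} → IsRatio q A B → IsRatio r A B → q ≡ r
isRatio-injective {B = B} (mkRatio q≡A/B) (mkRatio r≡A/B) = *-cancelʳ-≢0 (ℤ→ℚ (+ B)) (ℕ→ℚ-≢0 B) (trans q≡A/B (sym r≡A/B))

∏-positive : ∀ k {f : Fin k → ℚ} → (∀ i → Positive (f i)) → Positive (∏ k f)
∏-positive zero    _         = _
∏-positive (suc k) {f} pos = pos*pos⇒pos (f zero) {{pos zero}} (∏ k (f ∘ suc)) {{∏-positive k (pos ∘ suc)}}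

ppow-positive : ∀ p .{{_ : NonZero p}} z → Positive (ppow p z)
ppow-positive p (+ n)    = normalize-pos (p ^ n) 1 {{_}} {{ℕ.m^n≢0 p n}}
ppow-positive p -[1+ n ] = normalize-pos 1 (p ^ suc n) {{ℕ.m^n≢0 p (suc n)}}

infix 10 _⁺ _⁻

_⁺ _⁻ : ℤ → ℕ
(+ n)    ⁺ = n
-[1+ n ] ⁺ = 0
(+ n)    ⁻ = 0
-[1+ n ] ⁻ = suc n

isRatio-ppow : ∀ p .{{_ : NonZero p}} z → IsRatio (ppow p z) (p ^ z ⁺) (p ^ z ⁻)
isRatio-ppow p (+ n)    = mkRatio (ℚ.*-identityʳ (ℤ→ℚ (+ (p ^ n))))
isRatio-ppow p -[1+ n ] = mkRatio (i/n*n≡i (+ 1) (p ^ suc n) {{ℕ.m^n≢0 p (suc n)}})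

⁺-+* : ∀ n z → (+ n ℤ.* z) ⁺ ≡ n ℕ.* z ⁺
⁺-+* n       (+ m)    = cong _⁺ (sym (ℤ.pos-* n m))
⁺-+* zero    -[1+ m ] = refl
⁺-+* (suc n) -[1+ m ] = sym (ℕ.*-zeroʳ (suc n))

⁻-+* : ∀ n z → (+ n ℤ.* z) ⁻ ≡ n ℕ.* z ⁻
⁻-+* n       (+ m)    = trans (cong _⁻ (sym (ℤ.pos-* n m))) (sym (ℕ.*-zeroʳ n))
⁻-+* zero    -[1+ m ] = refl
⁻-+* (suc n) -[1+ m ] = refl

z≡z⁺-z⁻ : ∀ z → z ≡ + z ⁺ ℤ.- + z ⁻
z≡z⁺-z⁻ (+ n)    = sym (ℤ.+-identityʳ (+ n))
z≡z⁺-z⁻ -[1+ n ] = refl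

n*v+z⁻≡z⁺+n*w⇒z≡n*[v-w] : ∀ z n v w → n ℕ.* v ℕ.+ z ⁻ ≡ z ⁺ ℕ.+ n ℕ.* w → z ≡ + n ℤ.* (+ v ℤ.- + w)
n*v+z⁻≡z⁺+n*w⇒z≡n*[v-w] z n v w balanced = begin
  z                                                  ≡⟨ z≡z⁺-z⁻ z ⟩
  + z ⁺ ℤ.- + z ⁻                                    ≡⟨ solve 3 (λ a b c → a :- b := a :+ c :- c :- b) refl (+ z ⁺) (+ z ⁻) (+ n ℤ.* + w) ⟩
  + z ⁺ ℤ.+ + n ℤ.* + w ℤ.- + n ℤ.* + w ℤ.- + z ⁻    ≡⟨ cong (λ t → t ℤ.- + n ℤ.* + w ℤ.- + z ⁻) balancedℤ ⟨
  + n ℤ.* + v ℤ.+ + z ⁻ ℤ.- + n ℤ.* + w ℤ.- + z ⁻    ≡⟨ solve 4 (λ n v w b → n :* v :+ b :- n :* w :- b := n :* (v :- w)) refl (+ n) (+ v) (+ w) (+ z ⁻) ⟩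
  + n ℤ.* (+ v ℤ.- + w)                              ∎
  where
  open ≡-Reasoning
  open +-*-Solver
  balancedℤ : + n ℤ.* + v ℤ.+ + z ⁻ ≡ + z ⁺ ℤ.+ + n ℤ.* + w
  balancedℤ = begin
    + n ℤ.* + v ℤ.+ + z ⁻    ≡⟨ cong (ℤ._+ + z ⁻) (ℤ.pos-* n v) ⟨
    + (n ℕ.* v) ℤ.+ + z ⁻    ≡⟨ ℤ.pos-+ (n ℕ.* v) (z ⁻) ⟨
    + (n ℕ.* v ℕ.+ z ⁻)      ≡⟨ cong +_ balanced ⟩
    + (z ⁺ ℕ.+ n ℕ.* w)      ≡⟨ ℤ.pos-+ (z ⁺) (n ℕ.* w) ⟩
    + z ⁺ ℤ.+ + (n ℕ.* w)    ≡⟨ cong (+ z ⁺ ℤ.+_) (ℤ.pos-* n w) ⟩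
    + z ⁺ ℤ.+ + n ℤ.* + w    ∎

record Valuation (p n v : ℕ) : Set where
  constructor valuation
  field
    cofactor      : ℕ
    n≡p^v*cofactor : n ≡ p ^ v ℕ.* cofactor
    p∤cofactor    : p ∤ cofactor

module _ {p : ℕ} (p-prime : Prime p) where

  private instance
    p≢0 : NonZero p
    p≢0 = prime⇒nonZero p-prime

  prime≢1 : p ≢ 1
  prime≢1 = ℕ.nonTrivial⇒≢1 {{prime⇒nonTrivial p-prime}}

  prime∤1 : p ∤ 1
  prime∤1 = prime≢1 ∘ ∣1⇒≡1

  prime∤-* : ∀ {m n} → p ∤ m → p ∤ n → p ∤ m ℕ.* n
  prime∤-* p∤m p∤n = [ p∤m , p∤n ]′ ∘ euclidsLemma _ _ p-prime

  prime∤-^ : ∀ {m} e → p ∤ m → p ∤ m ^ e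
  prime∤-^ zero    p∤m = prime∤1
  prime∤-^ (suc e) p∤m = prime∤-* p∤m (prime∤-^ e p∤m)

  prime∤-∏ℕ : ∀ k {f : Fin k → ℕ} → (∀ i → p ∤ f i) → p ∤ ∏ℕ k f
  prime∤-∏ℕ zero    _     = prime∤1
  prime∤-∏ℕ (suc k) p∤f = prime∤-* (p∤f zero) (prime∤-∏ℕ k (p∤f ∘ suc))

  prime∤prime : ∀ {q} → Prime q → p ≢ q → p ∤ q
  prime∤prime q-prime p≢q = [ prime≢1 , p≢q ]′ ∘ prime⇒irreducible q-prime

  valuation-unique : ∀ {n v w} → Valuation p n v → Valuation p n w → v ≡ w
  valuation-unique {v = v} {w} (valuation r refl p∤r) (valuation s n≡p^w*s p∤s) = exponents-equal v w n≡p^w*s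
    where
    p∣p^[1+e]*m : ∀ e m → p ∣ p ^ suc e ℕ.* m
    p∣p^[1+e]*m e m = ∣-trans (m∣m*n (p ^ e)) (m∣m*n m)
    exponents-equal : ∀ v w → p ^ v ℕ.* r ≡ p ^ w ℕ.* s → v ≡ w
    exponents-equal zero    zero    _  = refl
    exponents-equal zero    (suc w) eq =
      contradiction (subst (p ∣_) (trans (sym eq) (ℕ.*-identityˡ r)) (p∣p^[1+e]*m w s)) p∤r
    exponents-equal (suc v) zero    eq =
      contradiction (subst (p ∣_) (trans eq (ℕ.*-identityˡ s)) (p∣p^[1+e]*m v r)) p∤s
    exponents-equal (suc v) (suc w) eq = cong suc (exponents-equal v w (ℕ.*-cancelˡ-≡ _ _ p (begin
      p ℕ.* (p ^ v ℕ.* r)   ≡⟨ ℕ.*-assoc p (p ^ v) r ⟨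
      p ^ suc v ℕ.* r       ≡⟨ eq ⟩
      p ^ suc w ℕ.* s       ≡⟨ ℕ.*-assoc p (p ^ w) s ⟩
      p ℕ.* (p ^ w ℕ.* s)   ∎)))
      where open ≡-Reasoning

  valuation-* : ∀ {m n v w} → Valuation p m v → Valuation p n w → Valuation p (m ℕ.* n) (v ℕ.+ w)
  valuation-* {v = v} {w} (valuation r refl p∤r) (valuation s refl p∤s) = valuation (r ℕ.* s) product (prime∤-* p∤r p∤s)
    where
    product : p ^ v ℕ.* r ℕ.* (p ^ w ℕ.* s) ≡ p ^ (v ℕ.+ w) ℕ.* (r ℕ.* s)
    product = trans (ℕ*.interchange (p ^ v) r (p ^ w) s) (cong (ℕ._* (r ℕ.* s)) (sym (ℕ.^-distribˡ-+-* p v w)))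

  valuation-^ : ∀ {n v} N → Valuation p n v → Valuation p (n ^ N) (N ℕ.* v)
  valuation-^ zero    _   = valuation 1 refl prime∤1
  valuation-^ (suc N) val = valuation-* val (valuation-^ N val)

  valuation-p^ : ∀ e → Valuation p (p ^ e) e
  valuation-p^ e = valuation 1 (sym (ℕ.*-identityʳ (p ^ e))) prime∤1

  ∤⇒valuation-0 : ∀ {n} → p ∤ n → Valuation p n 0
  ∤⇒valuation-0 {n} p∤n = valuation n (sym (ℕ.*-identityˡ n)) p∤n

  valuation-exists : ∀ n .{{_ : NonZero n}} → ∃[ v ] Valuation p n v
  valuation-exists = <-rec (λ n → .{{NonZero n}} → ∃[ v ] Valuation p n v) strip
    where
    strip : ∀ n → (∀ {m} → m ℕ.< n → .{{NonZero m}} → ∃[ v ] Valuation p m v) → .{{NonZero n}} → ∃[ v ] Valuation p n v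
    strip n rec with p ∣? n
    ... | no  p∤n = 0 , ∤⇒valuation-0 p∤n
    ... | yes (divides m refl) = valuation-*p (rec (ℕ.m<m*n m p (ℕ.nonTrivial⇒n>1 p {{prime⇒nonTrivial p-prime}})))
      where
      instance
        m≢0 : NonZero m
        m≢0 = ℕ.m*n≢0⇒m≢0 m
      valuation-*p : ∃[ v ] Valuation p m v → ∃[ v ] Valuation p (m ℕ.* p) v
      valuation-*p (v , valuation r refl p∤r) =
        suc v , valuation r (trans (ℕ.*-comm (p ^ v ℕ.* r) p) (sym (ℕ.*-assoc p (p ^ v) r))) p∤r

  valuation-∏ℕ : ∀ k {f : Fin k → ℕ} {v} i → Valuation p (f i) v → (∀ j → j ≢ i → p ∤ f j) → Valuation p (∏ℕ k f) v
  valuation-∏ℕ (suc k) {v = v} zero fi others =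
    subst (Valuation p _) (ℕ.+-identityʳ v) (valuation-* fi (∤⇒valuation-0 (prime∤-∏ℕ k (λ j → others (suc j) λ ()))))
  valuation-∏ℕ (suc k) (suc i) fi others =
    valuation-* (∤⇒valuation-0 (others zero λ ())) (valuation-∏ℕ k i fi (λ j j≢i → others (suc j) (j≢i ∘ Fin.suc-injective)))

record ClearedBy (N : ℕ) (β : ℚ) : Set where
  constructor clearedBy
  field
    numerator : ℤ
    numerator≡N*β : ℤ→ℚ numerator ≡ ℤ→ℚ (+ N) * β

↧ₙ-clears : ∀ β → ClearedBy (↧ₙ β) β
↧ₙ-clears β = clearedBy (↥ β) (trans (sym (p*↧p≡↥p β)) (ℚ.*-comm β (ℤ→ℚ (+ ↧ₙ β))))

clearedBy-*ˡ : ∀ M {N β} → ClearedBy N β → ClearedBy (M ℕ.* N) β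
clearedBy-*ˡ M {N} {β} (clearedBy e e≡Nβ) = clearedBy (+ M ℤ.* e) (begin
  ℤ→ℚ (+ M ℤ.* e)                     ≡⟨ ℤ→ℚ-homo-* (+ M) e ⟩
  ℤ→ℚ (+ M) * ℤ→ℚ e                   ≡⟨ cong (ℤ→ℚ (+ M) *_) e≡Nβ ⟩
  ℤ→ℚ (+ M) * (ℤ→ℚ (+ N) * β)         ≡⟨ ℚ.*-assoc (ℤ→ℚ (+ M)) (ℤ→ℚ (+ N)) β ⟨
  ℤ→ℚ (+ M) * ℤ→ℚ (+ N) * β           ≡⟨ cong (_* β) (ℕ→ℚ-homo-* M N) ⟨
  ℤ→ℚ (+ (M ℕ.* N)) * β               ∎)
  where open ≡-Reasoning

clearedBy-*ʳ : ∀ M {N β} → ClearedBy N β → ClearedBy (N ℕ.* M) β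
clearedBy-*ʳ M {N} {β} cleared = subst (λ L → ClearedBy L β) (ℕ.*-comm M N) (clearedBy-*ˡ M cleared)

clearedBy-multiple⇒isInteger : ∀ {N β} .{{_ : NonZero N}} (cleared : ClearedBy N β) →
                               ∃[ z ] ClearedBy.numerator cleared ≡ + N ℤ.* z → IsInteger β
clearedBy-multiple⇒isInteger {N} {β} (clearedBy e e≡Nβ) (z , refl) = z , *-cancelʳ-≢0 (ℤ→ℚ (+ N)) (ℕ→ℚ-≢0 N) (begin
  β * ℤ→ℚ (+ N)           ≡⟨ ℚ.*-comm β (ℤ→ℚ (+ N)) ⟩
  ℤ→ℚ (+ N) * β           ≡⟨ e≡Nβ ⟨
  ℤ→ℚ (+ N ℤ.* z)         ≡⟨ ℤ→ℚ-homo-* (+ N) z ⟩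
  ℤ→ℚ (+ N) * ℤ→ℚ z       ≡⟨ ℚ.*-comm (ℤ→ℚ (+ N)) (ℤ→ℚ z) ⟩
  ℤ→ℚ z * ℤ→ℚ (+ N)       ∎)
  where open ≡-Reasoning

commonDenominator : ∀ k (β : Fin k → ℚ) → ∃[ N ] NonZero N × (∀ i → ClearedBy N (β i))
commonDenominator zero    β = 1 , _ , λ ()
commonDenominator (suc k) β with commonDenominator k (β ∘ suc)
... | N , N≢0 , cleared = ↧ₙ (β zero) ℕ.* N , ℕ.m*n≢0 (↧ₙ (β zero)) N {{_}} {{N≢0}} , clears
  where
  clears : ∀ i → ClearedBy (↧ₙ (β zero) ℕ.* N) (β i)
  clears zero    = clearedBy-*ʳ N (↧ₙ-clears (β zero))
  clears (suc i) = clearedBy-*ˡ (↧ₙ (β zero)) (cleared i)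

isInteger-* : ∀ {p q} → IsInteger p → IsInteger q → IsInteger (p * q)
isInteger-* (a , refl) (b , refl) = a ℤ.* b , sym (ℤ→ℚ-homo-* a b)

↧ₙ≡1⇒isInteger : ∀ q → ↧ₙ q ≡ 1 → IsInteger q
↧ₙ≡1⇒isInteger (mkℚ a zero _) _ = a , sym (ℤ→ℚ≡fromℤ a)

coprime∧∣²⇒≡1 : ∀ {m n} → Coprime m n → n ∣ m ℕ.* m → n ≡ 1
coprime∧∣²⇒≡1 coprime n∣m² = coprime (coprime-divisor (Coprimality.sym coprime) n∣m² , ∣-refl)

isInteger-square⇒isInteger : ∀ q → IsInteger (q * q) → IsInteger q
isInteger-square⇒isInteger q@(mkℚ a _ coprime) (z , q²≡z) =
  ↧ₙ≡1⇒isInteger q (coprime∧∣²⇒≡1 (Coprimality.recompute coprime) (divides (ℤ.∣ z ∣ ℕ.* d) ∣a∣²≡∣z∣*d*d))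
  where
  open ≡-Reasoning
  d : ℕ
  d = ↧ₙ q
  a²≡z*d² : a ℤ.* a ≡ z ℤ.* + (d ℕ.* d)
  a²≡z*d² = ℤ→ℚ-injective (begin
    ℤ→ℚ (a ℤ.* a)                       ≡⟨ ℤ→ℚ-homo-* a a ⟩
    ℤ→ℚ a * ℤ→ℚ a                       ≡⟨ cong₂ _*_ (p*↧p≡↥p q) (p*↧p≡↥p q) ⟨
    q * ℤ→ℚ (+ d) * (q * ℤ→ℚ (+ d))     ≡⟨ ℚ*.interchange q (ℤ→ℚ (+ d)) q (ℤ→ℚ (+ d)) ⟩
    q * q * (ℤ→ℚ (+ d) * ℤ→ℚ (+ d))     ≡⟨ cong₂ _*_ q²≡z (sym (ℕ→ℚ-homo-* d d)) ⟩
    ℤ→ℚ z * ℤ→ℚ (+ (d ℕ.* d))           ≡⟨ ℤ→ℚ-homo-* z (+ (d ℕ.* d)) ⟨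
    ℤ→ℚ (z ℤ.* + (d ℕ.* d))             ∎)
  ∣a∣²≡∣z∣*d*d : ℤ.∣ a ∣ ℕ.* ℤ.∣ a ∣ ≡ ℤ.∣ z ∣ ℕ.* d ℕ.* d
  ∣a∣²≡∣z∣*d*d = begin
    ℤ.∣ a ∣ ℕ.* ℤ.∣ a ∣           ≡⟨ ℤ.abs-* a a ⟨
    ℤ.∣ a ℤ.* a ∣                 ≡⟨ cong ℤ.∣_∣ a²≡z*d² ⟩
    ℤ.∣ z ℤ.* + (d ℕ.* d) ∣       ≡⟨ ℤ.abs-* z (+ (d ℕ.* d)) ⟩
    ℤ.∣ z ∣ ℕ.* (d ℕ.* d)         ≡⟨ ℕ.*-assoc ℤ.∣ z ∣ d d ⟨
    ℤ.∣ z ∣ ℕ.* d ℕ.* d           ∎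

module _ {k} (p : Fin k → ℕ) (pr : ∀ i → Prime (p i)) where

  private instance
    p≢0 : ∀ {i} → NonZero (p i)
    p≢0 {i} = prime⇒nonZero (pr i)

  ∏p^ : (Fin k → ℤ) → ℚ
  ∏p^ e = ∏ k (λ i → ppow (p i) (e i))

  ∏ℕp^ : (Fin k → ℕ) → ℕ
  ∏ℕp^ E = ∏ℕ k (λ i → p i ^ E i)

  ∏ℕp^-nonZero : ∀ E → NonZero (∏ℕp^ E)
  ∏ℕp^-nonZero E = ∏ℕ-nonZero k (λ i → ℕ.m^n≢0 (p i) (E i))

  ∏ℕp^-* : ∀ N E → ∏ℕp^ (λ i → N ℕ.* E i) ≡ ∏ℕp^ E ^ N
  ∏ℕp^-* N E = trans (∏ℕ-cong k p^[N*E]≡[p^E]^N) (∏ℕ-^ k (λ i → p i ^ E i) N)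
    where
    p^[N*E]≡[p^E]^N : ∀ i → p i ^ (N ℕ.* E i) ≡ (p i ^ E i) ^ N
    p^[N*E]≡[p^E]^N i = trans (cong (p i ^_) (ℕ.*-comm N (E i))) (sym (ℕ.^-*-assoc (p i) (E i) N))

  ∏p^-positive : ∀ e → Positive (∏p^ e)
  ∏p^-positive e = ∏-positive k (λ i → ppow-positive (p i) (e i))

  isRatio-∏p^ : ∀ e → IsRatio (∏p^ e) (∏ℕp^ (_⁺ ∘ e)) (∏ℕp^ (_⁻ ∘ e))
  isRatio-∏p^ e = isRatio-∏ k (λ i → isRatio-ppow (p i) (e i))

  valuation-∏ℕp^ : Injective _≡_ _≡_ p → ∀ E i → Valuation (p i) (∏ℕp^ E) (E i)
  valuation-∏ℕp^ p-injective E i = valuation-∏ℕ (pr i) k i (valuation-p^ (pr i) (E i)) p∤other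
    where
    p∤other : ∀ j → j ≢ i → p i ∤ p j ^ E j
    p∤other j j≢i = prime∤-^ (pr i) (E j) (prime∤prime (pr i) (pr j) (j≢i ∘ sym ∘ p-injective))

  integers⇒prodPowIsRational : ∀ {β} → (∀ i → IsInteger (β i)) → ProdPowIsRational k p pr β
  integers⇒prodPowIsRational {β} integral = ∏p^ z , ∏p^-positive z , q^N≡∏p^e
    where
    z : Fin k → ℤ
    z = proj₁ ∘ integral
    q^N≡∏p^e : ∀ N → NonZero N → ∀ e → (∀ i → ℤ→ℚ (e i) ≡ ℤ→ℚ (+ N) * β i) → ∏p^ z ^ℚ N ≡ ∏p^ e
    q^N≡∏p^e N _ e cleared = isRatio-injective {{ℕ.m^n≢0 _ N {{∏ℕp^-nonZero (_⁻ ∘ z)}}}}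
      (isRatio-^ N (isRatio-∏p^ z))
      (subst₂ (IsRatio (∏p^ e)) (scaled _⁺ ⁺-+*) (scaled _⁻ ⁻-+*) (isRatio-∏p^ e))
      where
      e≡Nz : ∀ i → e i ≡ + N ℤ.* z i
      e≡Nz i = ℤ→ℚ-injective (begin
        ℤ→ℚ (e i)                   ≡⟨ cleared i ⟩
        ℤ→ℚ (+ N) * β i             ≡⟨ cong (ℤ→ℚ (+ N) *_) (proj₂ (integral i)) ⟩
        ℤ→ℚ (+ N) * ℤ→ℚ (z i)       ≡⟨ ℤ→ℚ-homo-* (+ N) (z i) ⟨
        ℤ→ℚ (+ N ℤ.* z i)           ∎)
        where open ≡-Reasoning
      scaled : (part : ℤ → ℕ) → (∀ n z → part (+ n ℤ.* z) ≡ n ℕ.* part z) → ∏ℕp^ (part ∘ e) ≡ ∏ℕp^ (part ∘ z) ^ N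
      scaled part part-+* = trans (∏ℕ-cong k (λ i → cong (p i ^_) (trans (cong part (e≡Nz i)) (part-+* N (z i))))) (∏ℕp^-* N (part ∘ z))

  module _ (p-injective : Injective _≡_ _≡_ p) where

    exponents-divisible : ∀ N n m .{{_ : NonZero n}} .{{_ : NonZero m}} e →
                          n ^ N ℕ.* ∏ℕp^ (_⁻ ∘ e) ≡ ∏ℕp^ (_⁺ ∘ e) ℕ.* m ^ N →
                          ∀ i → ∃[ z ] e i ≡ + N ℤ.* z
    exponents-divisible N n m e cross-multiplied i with valuation-exists (pr i) n | valuation-exists (pr i) m
    ... | v , vₙ | w , wₘ = + v ℤ.- + w , n*v+z⁻≡z⁺+n*w⇒z≡n*[v-w] (e i) N v w (valuation-unique (pr i) lhs rhs)
      where
      lhs : Valuation (p i) (n ^ N ℕ.* ∏ℕp^ (_⁻ ∘ e)) (N ℕ.* v ℕ.+ e i ⁻)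
      lhs = valuation-* (pr i) (valuation-^ (pr i) N vₙ) (valuation-∏ℕp^ p-injective (_⁻ ∘ e) i)
      rhs : Valuation (p i) (n ^ N ℕ.* ∏ℕp^ (_⁻ ∘ e)) (e i ⁺ ℕ.+ N ℕ.* w)
      rhs = subst (λ x → Valuation (p i) x (e i ⁺ ℕ.+ N ℕ.* w)) (sym cross-multiplied)
              (valuation-* (pr i) (valuation-∏ℕp^ p-injective (_⁺ ∘ e) i) (valuation-^ (pr i) N wₘ))

    prodPowIsRational⇒integers : ∀ {β} → ProdPowIsRational k p pr β → ∀ i → IsInteger (β i)
    prodPowIsRational⇒integers {β} (q@(mkℚ +[1+ n ] d _) , _ , q^N≡∏p^) i with commonDenominator k β
    ... | N , N≢0 , cleared =
      clearedBy-multiple⇒isInteger {{N≢0}} (cleared i) (exponents-divisible N (suc n) (suc d) e cross-multiplied i)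
      where
      e : Fin k → ℤ
      e = ClearedBy.numerator ∘ cleared
      q^N≡∏p^e : q ^ℚ N ≡ ∏p^ e
      q^N≡∏p^e = q^N≡∏p^ N N≢0 e (ClearedBy.numerator≡N*β ∘ cleared)
      cross-multiplied : suc n ^ N ℕ.* ∏ℕp^ (_⁻ ∘ e) ≡ ∏ℕp^ (_⁺ ∘ e) ℕ.* suc d ^ N
      cross-multiplied = isRatio-cross
        (subst (λ x → IsRatio x (suc n ^ N) (suc d ^ N)) q^N≡∏p^e (isRatio-^ N (mkRatio (p*↧p≡↥p q))))
        (isRatio-∏p^ e)
    prodPowIsRational⇒integers (mkℚ (+ zero) _ _ , () , _)
    prodPowIsRational⇒integers (mkℚ -[1+ _ ] _ _ , () , _)

lemma2p1 : (k : ℕ) (α : Fin k → ℚ) (p : Fin k → ℕ) (pr : ∀ i → Prime (p i)) → Injective _≡_ _≡_ p →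
    ((∀ i → IsInteger (α i)) ⇔ ProdPowIsRational k p pr α) × ((∀ i → IsInteger (α i)) ⇔ ProdPowIsRational k p pr (λ i → α i * α i))
lemma2p1 k α p pr p-injective =
  mk⇔ (integers⇒prodPowIsRational p pr) (prodPowIsRational⇒integers p pr p-injective) ,
  mk⇔ (λ integral → integers⇒prodPowIsRational p pr (λ i → isInteger-* (integral i) (integral i)))
      (λ rational i → isInteger-square⇒isInteger (α i) (prodPowIsRational⇒integers p pr p-injective rational i))
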